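{- Let $n\ge 4$ and let $A=A(x)$ be an $n$-by-$n$ partial reciprocal matrix in which every entry is specified except the $(1,n)$ entry $x$ and the $(n,1)$ entry $1/x$. Let $MT(A)$ be the maximum of the $3$-cycle products $a_{ij}a_{jk}a_{ki}$ over all distinct $i,j,k$ with $\{i,k\}\neq\{1,n\}$, $\{i,j\}\ne\{1,n\}$, $\{j,k\}\neq\{1,n\}$ (i.e. over all $3$-cycles consisting of specified entries). Let $S(A)=\{a_{1j}a_{jn}:2\le j\le n-1\}$, $M_S(A)=\max S(A)$ and $m_S(A)=\min S(A)$. Then $$M_S(A)\le (MT(A))^2\, m_S(A).$$
   Context: A partial reciprocal matrix has diagonal entries $1$, symmetric pattern of specified entries, and specified entries positive with $a_{ji}=1/a_{ij}$ whenever $a_{ij}$ is specified. -}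

module Defs where

open import Level using (Level; _⊔_) renaming (suc to lsuc)
open import Data.Nat using (ℕ)
open import Data.Fin using (Fin; fromℕ) renaming (zero to fzero)
open import Data.Product using (_×_; ∃; ∃-syntax; _,_)
open import Data.Sum using (_⊎_)
open import Relation.Nullary using (¬_)
open import Relation.Binary.Core using (Rel)
open import Relation.Binary.Structures using (IsTotalOrder)
open import Relation.Binary.PropositionalEquality using (_≡_)
open import Algebra.Bundles using (CommutativeRing)

record OrderedField (c ℓ₁ ℓ₂ : Level) : Set (lsuc (c ⊔ ℓ₁ ⊔ ℓ₂)) where
  field
    commutativeRing : CommutativeRing c ℓ₁
  open CommutativeRing commutativeRing public
  field
    _≤_          : Rel Carrier ℓ₂
    isTotalOrder : IsTotalOrder _≈_ _≤_
    +-mono-≤     : ∀ {x y} z → x ≤ y → (x + z) ≤ (y + z)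
    *-nonneg     : ∀ {x y} → 0# ≤ x → 0# ≤ y → 0# ≤ (x * y)
    0≉1          : ¬ (0# ≈ 1#)
    *-inverse    : ∀ x → ¬ (x ≈ 0#) → ∃[ y ] (x * y ≈ 1#)


module _ {c ℓ₁ ℓ₂ : Level} (F : OrderedField c ℓ₁ ℓ₂) where
  open OrderedField F using (Carrier; _≈_; _≤_; _*_; 0#; 1#)

  Lt : Carrier → Carrier → Set (ℓ₁ ⊔ ℓ₂)
  Lt x y = x ≤ y × ¬ (x ≈ y)

  IsMax : ∀ {p} → (Carrier → Set p) → Carrier → Set (c ⊔ p ⊔ ℓ₂)
  IsMax P t = P t × (∀ s → P s → s ≤ t)

  IsMin : ∀ {p} → (Carrier → Set p) → Carrier → Set (c ⊔ p ⊔ ℓ₂)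
  IsMin P t = P t × (∀ s → P s → t ≤ s)

  -- n = suc k; indices Fin (suc k); row/column 1 is `zero`, row/column n is `fromℕ k`.
  -- The only unspecified positions are (1,n) and (n,1).
  Specified : (k : ℕ) → Fin (ℕ.suc k) → Fin (ℕ.suc k) → Set
  Specified k i j = ¬ ((i ≡ fzero × j ≡ fromℕ k) ⊎ (i ≡ fromℕ k × j ≡ fzero))

  -- A partial reciprocal matrix with exactly the (1,n),(n,1) entries unspecified
  -- (values of `a` at unspecified positions are irrelevant).
  PartialReciprocal : (k : ℕ) → (Fin (ℕ.suc k) → Fin (ℕ.suc k) → Carrier) → Set (ℓ₁ ⊔ ℓ₂)
  PartialReciprocal k a =
    (∀ i → a i i ≈ 1#) ×
    (∀ i j → Specified k i j → Lt 0# (a i j) × (a j i * a i j ≈ 1#))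

  ThreeCycleProduct : (k : ℕ) → (Fin (ℕ.suc k) → Fin (ℕ.suc k) → Carrier) → Carrier → Set ℓ₁
  ThreeCycleProduct k a t =
    ∃[ i ] ∃[ j ] ∃[ l ]
      (¬ i ≡ j) × (¬ j ≡ l) × (¬ i ≡ l) ×
      Specified k i j × Specified k j l × Specified k l i ×
      (t ≈ (a i j * a j l) * a l i)

  SSet : (k : ℕ) → (Fin (ℕ.suc k) → Fin (ℕ.suc k) → Carrier) → Carrier → Set ℓ₁
  SSet k a s = ∃[ j ] (¬ j ≡ fzero) × (¬ j ≡ fromℕ k) × (s ≈ a fzero j * a j (fromℕ k))

-- For two distinct inner indices p and q, the path products a₁ₚaₚₙ and a₁qaqₙ
-- differ by the product of the two fully specified 3-cycles (1,p,q) and (q,p,n):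
-- by reciprocity  a₁ₚaₚₙ = (a₁ₚaₚqaq₁)(aqₚaₚₙaₙq) · a₁qaqₙ,  so the ratio is at most
-- MT².  If the maximum and the minimum of S(A) are attained at the same index,
-- then S(A) is a single value and any other inner index (n ≥ 4) gives the bound.
module Submission where

open import Defs
open import Level using (Level)
open import Data.Nat using (ℕ; suc; s≤s) renaming (_≤_ to _≤ℕ_)
open import Data.Fin using (Fin; fromℕ) renaming (zero to fzero; suc to fsuc)
open import Data.Fin.Properties using (_≟_)
open import Data.Product using (_×_; _,_; proj₁; proj₂; ∃-syntax)
open import Data.Sum using (inj₁; inj₂)
open import Relation.Nullary using (¬_; yes; no)
open import Relation.Binary.Bundles using (Poset)
open import Relation.Binary.Definitions using (DecidableEquality)
open import Relation.Binary.PropositionalEquality using (_≡_; _≢_; refl; ≢-sym)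
open import Relation.Binary.Structures using (IsTotalOrder)
import Algebra.Properties.Group as GroupProperties
import Algebra.Solver.CommutativeMonoid as CommutativeMonoidSolver
import Relation.Binary.Reasoning.PartialOrder as PartialOrderReasoning

module OrderedFieldProperties {c ℓ₁ ℓ₂ : Level} (F : OrderedField c ℓ₁ ℓ₂) where
  open OrderedField F
  open IsTotalOrder isTotalOrder using (antisym; isPartialOrder)
    renaming (trans to ≤-trans; reflexive to ≤-reflexive)
  open GroupProperties +-group using (//-rightDividesˡ)

  poset : Poset c ℓ₁ ℓ₂
  poset = record { isPartialOrder = isPartialOrder }

  open PartialOrderReasoning poset

  x≤y⇒0≤y-x : ∀ {x y} → x ≤ y → 0# ≤ (y - x)
  x≤y⇒0≤y-x {x} {y} x≤y = begin
    0#     ≈⟨ -‿inverseʳ x ⟨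
    x - x  ≤⟨ +-mono-≤ (- x) x≤y ⟩
    y - x  ∎

  *-monoʳ-≤-nonNeg : ∀ {z} → 0# ≤ z → ∀ {x y} → x ≤ y → (x * z) ≤ (y * z)
  *-monoʳ-≤-nonNeg {z} 0≤z {x} {y} x≤y = begin
    x * z                ≈⟨ +-identityˡ (x * z) ⟨
    0# + x * z           ≤⟨ +-mono-≤ (x * z) (*-nonneg (x≤y⇒0≤y-x x≤y) 0≤z) ⟩
    (y - x) * z + x * z  ≈⟨ distribʳ z (y - x) x ⟨
    (y - x + x) * z      ≈⟨ *-congʳ (//-rightDividesˡ x y) ⟩
    y * z                ∎

  *-mono-≤-nonNeg : ∀ {x X y Y} → 0# ≤ x → x ≤ X → 0# ≤ y → y ≤ Y → (x * y) ≤ (X * Y)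
  *-mono-≤-nonNeg {x} {X} {y} {Y} 0≤x x≤X 0≤y y≤Y = begin
    x * y  ≤⟨ *-monoʳ-≤-nonNeg 0≤y x≤X ⟩
    X * y  ≈⟨ *-comm X y ⟩
    y * X  ≤⟨ *-monoʳ-≤-nonNeg (≤-trans 0≤x x≤X) y≤Y ⟩
    Y * X  ≈⟨ *-comm Y X ⟩
    X * Y  ∎

  module _ {i} {I : Set i} (_≟ᵢ_ : DecidableEquality I)
           (P : I → Set) (f : I → Carrier) (κ : Carrier)
           (ratio-bound : ∀ {p q} → P p → P q → p ≢ q → f p ≤ (κ * f q)) where

    max≤scaled-min : ∀ {r₁ r₂} → P r₁ → P r₂ → r₁ ≢ r₂ →
                     ∀ {M m p q} → P p → M ≈ f p → (∀ j → P j → f j ≤ M) →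
                                   P q → m ≈ f q → (∀ j → P j → m ≤ f j) →
                     M ≤ (κ * m)
    max≤scaled-min {r₁} {r₂} Pr₁ Pr₂ r₁≢r₂ {M} {m} {p} {q} Pp M≈fp M-max Pq m≈fq m-min
      with p ≟ᵢ q
    ... | no p≢q = begin
      M        ≈⟨ M≈fp ⟩
      f p      ≤⟨ ratio-bound Pp Pq p≢q ⟩
      κ * f q  ≈⟨ *-congˡ m≈fq ⟨
      κ * m    ∎
    ... | yes refl = begin
      M        ≈⟨ M≈fp ⟩
      f p      ≤⟨ ratio-bound Pp Pr p≢r ⟩
      κ * f r  ≈⟨ *-congˡ fr≈m ⟩
      κ * m    ∎
      where
      other : ∃[ r ] P r × p ≢ r
      other with p ≟ᵢ r₁
      ... | no p≢r₁  = r₁ , Pr₁ , p≢r₁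
      ... | yes refl = r₂ , Pr₂ , r₁≢r₂
      r = proj₁ other
      Pr = proj₁ (proj₂ other)
      p≢r = proj₂ (proj₂ other)
      fr≈m : f r ≈ m
      fr≈m = antisym (≤-trans (M-max r Pr) (≤-reflexive (trans M≈fp (sym m≈fq)))) (m-min r Pr)

module PathProducts {c ℓ₁ ℓ₂ : Level} (F : OrderedField c ℓ₁ ℓ₂) (k : ℕ)
                    (a : Fin (suc k) → Fin (suc k) → OrderedField.Carrier F)
                    (a-reciprocal : PartialReciprocal F k a) where
  open OrderedField F renaming (refl to ≈-refl)
  open OrderedFieldProperties F using (poset; *-monoʳ-≤-nonNeg; *-mono-≤-nonNeg)
  open PartialOrderReasoning poset
  open CommutativeMonoidSolver *-commutativeMonoid using (solve; _⊜_; _⊕_)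

  first last : Fin (suc k)
  first = fzero
  last  = fromℕ k

  Inner : Fin (suc k) → Set
  Inner j = ¬ j ≡ first × ¬ j ≡ last

  inner-specifiedˡ : ∀ {i j} → Inner i → Specified F k i j
  inner-specifiedˡ (i≢1 , _) (inj₁ (i≡1 , _)) = i≢1 i≡1
  inner-specifiedˡ (_ , i≢n) (inj₂ (i≡n , _)) = i≢n i≡n

  inner-specifiedʳ : ∀ {i j} → Inner j → Specified F k i j
  inner-specifiedʳ (_ , j≢n) (inj₁ (_ , j≡n)) = j≢n j≡n
  inner-specifiedʳ (j≢1 , _) (inj₂ (_ , j≡1)) = j≢1 j≡1

  entry-nonNeg : ∀ {i j} → Specified F k i j → 0# ≤ a i j
  entry-nonNeg sp = proj₁ (proj₁ (proj₂ a-reciprocal _ _ sp))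

  entry-inverse : ∀ {i j} → Specified F k i j → a j i * a i j ≈ 1#
  entry-inverse sp = proj₂ (proj₂ a-reciprocal _ _ sp)

  cycleProduct : Fin (suc k) → Fin (suc k) → Fin (suc k) → Carrier
  cycleProduct i j l = (a i j * a j l) * a l i

  cycleProduct-nonNeg : ∀ {i j l} → Specified F k i j → Specified F k j l → Specified F k l i →
                        0# ≤ cycleProduct i j l
  cycleProduct-nonNeg sij sjl sli =
    *-nonneg (*-nonneg (entry-nonNeg sij) (entry-nonNeg sjl)) (entry-nonNeg sli)

  pathProduct : Fin (suc k) → Carrier
  pathProduct j = a first j * a j last

  pathProduct-nonNeg : ∀ {j} → Inner j → 0# ≤ pathProduct j
  pathProduct-nonNeg j-inner =
    *-nonneg (entry-nonNeg (inner-specifiedʳ j-inner)) (entry-nonNeg (inner-specifiedˡ j-inner))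

  pathProduct-via-cycles : ∀ {p q} → Inner p → Inner q →
    pathProduct p ≈ (cycleProduct first p q * cycleProduct q p last) * pathProduct q
  pathProduct-via-cycles {p} {q} p-inner q-inner = sym (begin-equality
    (cycleProduct first p q * cycleProduct q p last) * pathProduct q
      ≈⟨ solve 8 (λ x₁ₚ xₚq xq₁ xqₚ xₚₙ xₙq x₁q xqₙ →
                    (((x₁ₚ ⊕ xₚq) ⊕ xq₁) ⊕ ((xqₚ ⊕ xₚₙ) ⊕ xₙq)) ⊕ (x₁q ⊕ xqₙ)
                  ⊜ (x₁ₚ ⊕ xₚₙ) ⊕ ((xq₁ ⊕ x₁q) ⊕ ((xₚq ⊕ xqₚ) ⊕ (xₙq ⊕ xqₙ))))
               ≈-refl (a first p) (a p q) (a q first) (a q p) (a p last) (a last q) (a first q) (a q last) ⟩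
    pathProduct p * ((a q first * a first q) * ((a p q * a q p) * (a last q * a q last)))
      ≈⟨ *-congˡ (*-cong (entry-inverse (inner-specifiedʳ q-inner))
                 (*-cong (entry-inverse (inner-specifiedˡ q-inner))
                         (entry-inverse (inner-specifiedˡ q-inner)))) ⟩
    pathProduct p * (1# * (1# * 1#))
      ≈⟨ *-congˡ (trans (*-identityˡ _) (*-identityˡ _)) ⟩
    pathProduct p * 1#
      ≈⟨ *-identityʳ _ ⟩
    pathProduct p ∎)

  module _ {MT : Carrier} (MT-max : IsMax F (ThreeCycleProduct F k a) MT) where

    cycleProduct≤MT : ∀ {i j l} → i ≢ j → j ≢ l → i ≢ l →
                      Specified F k i j → Specified F k j l → Specified F k l i →
                      cycleProduct i j l ≤ MT
    cycleProduct≤MT {i} {j} {l} i≢j j≢l i≢l sij sjl sli =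
      proj₂ MT-max _ (i , j , l , i≢j , j≢l , i≢l , sij , sjl , sli , ≈-refl)

    pathProduct-ratio : ∀ {p q} → Inner p → Inner q → p ≢ q →
                        pathProduct p ≤ ((MT * MT) * pathProduct q)
    pathProduct-ratio {p} {q} p-inner@(p≢1 , p≢n) q-inner@(q≢1 , q≢n) p≢q = begin
      pathProduct p
        ≈⟨ pathProduct-via-cycles p-inner q-inner ⟩
      (cycleProduct first p q * cycleProduct q p last) * pathProduct q
        ≤⟨ *-monoʳ-≤-nonNeg (pathProduct-nonNeg q-inner)
             (*-mono-≤-nonNeg
               (cycleProduct-nonNeg s₁ₚ sₚq sq₁)
               (cycleProduct≤MT (≢-sym p≢1) p≢q (≢-sym q≢1) s₁ₚ sₚq sq₁)
               (cycleProduct-nonNeg sqₚ sₚₙ sₙq)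
               (cycleProduct≤MT (≢-sym p≢q) p≢n q≢n sqₚ sₚₙ sₙq)) ⟩
      (MT * MT) * pathProduct q
        ∎
      where
      s₁ₚ = inner-specifiedʳ p-inner
      sₚq = inner-specifiedˡ p-inner
      sq₁ = inner-specifiedˡ q-inner
      sqₚ = inner-specifiedˡ q-inner
      sₚₙ = inner-specifiedˡ p-inner
      sₙq = inner-specifiedʳ q-inner

lemma5p1 : ∀ {c ℓ₁ ℓ₂ : Level} (F : OrderedField c ℓ₁ ℓ₂) →
    let open OrderedField F in
    (k : ℕ) → 3 ≤ℕ k →
    (a : Fin (suc k) → Fin (suc k) → Carrier) →
    PartialReciprocal F k a →
    (MT MS mS : Carrier) →
    IsMax F (ThreeCycleProduct F k a) MT →
    IsMax F (SSet F k a) MS →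
    IsMin F (SSet F k a) mS →
    MS ≤ ((MT * MT) * mS)
lemma5p1 F k@(suc (suc (suc _))) (s≤s (s≤s (s≤s _))) a a-reciprocal MT MS mS MT-max
         ((p , p≢1 , p≢n , MS≈) , MS-max) ((q , q≢1 , q≢n , mS≈) , mS-min) =
  max≤scaled-min _≟_ Inner pathProduct (MT * MT) (pathProduct-ratio MT-max)
    {fsuc fzero} {fsuc (fsuc fzero)} ((λ ()) , (λ ())) ((λ ()) , (λ ())) (λ ())
    (p≢1 , p≢n) MS≈ (λ j (j≢1 , j≢n) → MS-max _ (j , j≢1 , j≢n , ≈-refl))
    (q≢1 , q≢n) mS≈ (λ j (j≢1 , j≢n) → mS-min _ (j , j≢1 , j≢n , ≈-refl))
  where
  open OrderedField F using (_*_) renaming (refl to ≈-refl)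
  open OrderedFieldProperties F using (max≤scaled-min)
  open PathProducts F k a a-reciprocal using (Inner; pathProduct; pathProduct-ratio)
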